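{- Let $M=(S,\mathcal{I})$ be a matroid, $S_0\subseteq S$ a set such that some basis of $M$ is not contained in $S_0$, and $w\in\mathbb{Z}^S$. Let $\widehat{\delta}\in\mathbb{Z}_+$ be the optimum value of the Relaxed-IM-Not-Exists instance $(M,S_0,w,\|\cdot\|_\infty)$ under integrality constraints. Then either $w+\widehat{\delta}\cdot(\chi_{S\setminus S_0}-\chi_{S_0})$ or $w+(\widehat{\delta}+1)\cdot(\chi_{S\setminus S_0}-\chi_{S_0})$ is an optimal solution of the IM-Not-Exists instance $(M,S_0,w,\|\cdot\|_\infty)$.
   Context: Relaxed-IM-Not-Exists under integrality constraints: find $\widehat{w}\in\mathbb{Z}^S$ such that some basis of $M$ not contained in $S_0$ is a maximum $\widehat{w}$-weight basis, minimizing $\|w-\widehat{w}\|_\infty=\max_s|w(s)-\widehat{w}(s)|$. IM-Not-Exists: find $w^*\in\mathbb{Z}^S$ such that no basis contained in $S_0$ is a maximum $w^*$-weight basis of $M$, minimizing $\|w-w^*\|_\infty$. $\chi_Z$ is the characteristic vector of $Z$. -}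

module Defs where

open import Data.Nat as ℕ using (ℕ; zero; suc; _⊔_; _<_)
open import Data.Integer as ℤ using (ℤ; +_; _-_; _*_) renaming (_+_ to _+ℤ_; _≤_ to _≤ℤ_)
open import Data.Fin using (Fin; zero; suc)
open import Data.Fin.Subset using (Subset; inside; outside; _∈_; _∉_; _⊆_; _∪_; ⁅_⁆; ∣_∣; ∁; ⊥)
open import Data.Vec using ([]; _∷_; lookup)
open import Data.Product using (Σ; ∃; _×_)
open import Relation.Nullary using (¬_; Dec)
open import Relation.Unary using (Decidable)
open import Relation.Binary.PropositionalEquality using (_≡_)

-- A matroid on the ground set S = Fin n, given by its independent sets
-- (independence is assumed decidable: an independence oracle).
record Matroid (n : ℕ) : Set₁ where
  field
    Indep      : Subset n → Set
    indep?     : Decidable Indep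
    indep-∅    : Indep ⊥
    hereditary : ∀ {X Y} → Y ⊆ X → Indep X → Indep Y
    exchange   : ∀ {X Y} → Indep X → Indep Y → ∣ X ∣ < ∣ Y ∣ →
                 ∃ λ e → e ∈ Y × e ∉ X × Indep (X ∪ ⁅ e ⁆)

open Matroid public

IsBasis : ∀ {n} → Matroid n → Subset n → Set
IsBasis M B = Indep M B × (∀ X → Indep M X → B ⊆ X → X ≡ B)

weight : ∀ {n} → (Fin n → ℤ) → Subset n → ℤ
weight {zero}  w []            = + 0
weight {suc n} w (inside  ∷ X) = w zero +ℤ weight (λ i → w (suc i)) X
weight {suc n} w (outside ∷ X) = weight (λ i → w (suc i)) X

IsMaxWeightBasis : ∀ {n} → Matroid n → (Fin n → ℤ) → Subset n → Set
IsMaxWeightBasis M w B = IsBasis M B × (∀ B′ → IsBasis M B′ → weight w B′ ≤ℤ weight w B)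

-- ℓ∞ distance ‖w − w′‖∞ = max_s |w(s) − w′(s)| (0 on an empty ground set)
distInf : ∀ {n} → (Fin n → ℤ) → (Fin n → ℤ) → ℕ
distInf {zero}  w w′ = 0
distInf {suc n} w w′ = ℤ.∣ w zero - w′ zero ∣ ⊔ distInf (λ i → w (suc i)) (λ i → w′ (suc i))

χ : ∀ {n} → Subset n → Fin n → ℤ
χ Z i with lookup Z i
... | inside  = + 1
... | outside = + 0

shift : ∀ {n} → (Fin n → ℤ) → Subset n → ℕ → Fin n → ℤ
shift w S₀ c i = w i +ℤ (+ c) * (χ (∁ S₀) i - χ S₀ i)

RelaxedFeasible : ∀ {n} → Matroid n → Subset n → (Fin n → ℤ) → Set
RelaxedFeasible M S₀ ŵ = ∃ λ B → IsMaxWeightBasis M ŵ B × ¬ (B ⊆ S₀)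

NotExistsFeasible : ∀ {n} → Matroid n → Subset n → (Fin n → ℤ) → Set
NotExistsFeasible M S₀ w* = ∀ B → B ⊆ S₀ → ¬ IsMaxWeightBasis M w* B

IsRelaxedOptValue : ∀ {n} → Matroid n → Subset n → (Fin n → ℤ) → ℕ → Set
IsRelaxedOptValue M S₀ w δ =
  (∃ λ ŵ → RelaxedFeasible M S₀ ŵ × distInf w ŵ ≡ δ) ×
  (∀ ŵ → RelaxedFeasible M S₀ ŵ → δ ℕ.≤ distInf w ŵ)

IsNotExistsOptimal : ∀ {n} → Matroid n → Subset n → (Fin n → ℤ) → (Fin n → ℤ) → Set
IsNotExistsOptimal M S₀ w w* =
  NotExistsFeasible M S₀ w* ×
  (∀ w′ → NotExistsFeasible M S₀ w′ → distInf w w* ℕ.≤ distInf w w′)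

-- The engine is an exchange property of matroids: if B₀ is a maximum u-weight basis and e ∉ B₀
-- lies in a basis B, then B − e + a is a basis for some a ∈ B₀ with u e ≤ u a.  Take
-- u = w + c·(χ_{S∖S₀} − χ_{S₀}), B₀ ⊆ S₀ and e ∉ S₀: then u e ≤ u a means w a − w e ≥ 2c, so
-- w′ e ≤ w′ a whenever ‖w − w′‖∞ ≤ c, and w′ e < w′ a whenever ‖w − w′‖∞ < c.
-- In the first case the exchange turns a maximum w′-basis with the most elements in S₀ into
-- another one with more; so if some IM-Not-Exists solution lies within distance c, the shift
-- by c is one too.  In the second case, with c = δ̂ + 1 and the optimal relaxed solution ŵ,
-- the exchange turns a maximum ŵ-basis B* ⊈ S₀ into a heavier basis; so the shift by δ̂ + 1
-- is feasible.  Every IM-Not-Exists solution is a relaxed one, hence at distance ≥ δ̂, and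
-- distance exactly δ̂ is attained only if the shift by δ̂ is feasible.
module Submission where

open import Defs
open import Data.Nat using (ℕ; suc)
open import Data.Integer using (ℤ)
open import Data.Fin using (Fin)
open import Data.Fin.Subset using (Subset; _⊆_)
open import Data.Product using (∃; _×_)
open import Data.Sum using (_⊎_)
open import Relation.Nullary using (¬_)

open import Data.Nat as ℕ using (zero; s≤s)
import Data.Nat.Properties as ℕ
open import Data.Integer as ℤ using (+_; -[1+_]; +≤+; -≤+; -≤-; +<+; _+_; _-_; -_; _≤_; _<_)
import Data.Integer.Properties as ℤ
open import Data.Integer.Tactic.RingSolver using (solve-∀)
open import Algebra.Properties.CommutativeSemigroup ℤ.+-commutativeSemigroup using (xy∙z≈xz∙y)
open import Data.Bool using (true; false) renaming (_≟_ to _≟ᵇ_)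
open import Data.Fin using (zero; suc; _≟_)
import Data.Fin.Properties as Fin
open import Data.Fin.Subset using (inside; outside; _∈_; _∉_; _⊈_; _∪_; _─_; ⁅_⁆; ∣_∣)
open import Data.Fin.Subset.Properties
open import Data.Vec using ([]; _∷_; lookup; tabulate; here; there)
open import Data.Vec.Properties using (≡-dec; []=⇒lookup; lookup⇒[]=; lookup∘tabulate)
open import Data.Product using (_,_; proj₁; proj₂)
open import Data.Sum using (inj₁; inj₂)
open import Function using (_∘_; id; case_of_)
open import Level using (Level)
open import Relation.Nullary using (Dec; yes; no; does; contradiction; ¬?)
open import Relation.Nullary.Decidable using (_×-dec_; _→-dec_; dec-true; dec-false; decidable-stable)
open import Relation.Unary using (Pred; Decidable)
open import Relation.Binary.PropositionalEquality

private
  variable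
    n : ℕ
    ℓ : Level
    p q : Subset n
    x y : Fin n

∣i∣≤k⇒-k≤i : ∀ i {k} → ℤ.∣ i ∣ ℕ.≤ k → - + k ≤ i
∣i∣≤k⇒-k≤i (+ m)    _         = ℤ.neg-≤-pos
∣i∣≤k⇒-k≤i -[1+ m ] (s≤s m≤k) = -≤- m≤k

∣i∣≤k⇒i≤k : ∀ i {k} → ℤ.∣ i ∣ ℕ.≤ k → i ≤ + k
∣i∣≤k⇒i≤k (+ m)    m≤k = +≤+ m≤k
∣i∣≤k⇒i≤k -[1+ m ] _   = -≤+

∣i-j∣≤k⇒j≤i+k : ∀ i j {k} → ℤ.∣ i - j ∣ ℕ.≤ k → j ≤ i + + k
∣i-j∣≤k⇒j≤i+k i j {k} ∣i-j∣≤k = begin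
  j                     ≡⟨ cancel j (+ k) ⟨
  - + k + (j + + k)     ≤⟨ ℤ.+-monoˡ-≤ (j + + k) (∣i∣≤k⇒-k≤i (i - j) ∣i-j∣≤k) ⟩
  (i - j) + (j + + k)   ≡⟨ telescope i j (+ k) ⟩
  i + + k               ∎
  where
  open ℤ.≤-Reasoning
  cancel : ∀ j k → - k + (j + k) ≡ j
  cancel = solve-∀
  telescope : ∀ i j k → (i - j) + (j + k) ≡ i + k
  telescope = solve-∀

∣i-j∣≤k⇒i-k≤j : ∀ i j {k} → ℤ.∣ i - j ∣ ℕ.≤ k → i - + k ≤ j
∣i-j∣≤k⇒i-k≤j i j {k} ∣i-j∣≤k = begin
  i - + k               ≡⟨ telescope i j (+ k) ⟨
  (i - j) + (j - + k)   ≤⟨ ℤ.+-monoˡ-≤ (j - + k) (∣i∣≤k⇒i≤k (i - j) ∣i-j∣≤k) ⟩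
  + k + (j - + k)       ≡⟨ cancel j (+ k) ⟩
  j                     ∎
  where
  open ℤ.≤-Reasoning
  telescope : ∀ i j k → (i - j) + (j - k) ≡ i - k
  telescope = solve-∀
  cancel : ∀ j k → k + (j - k) ≡ j
  cancel = solve-∀

≤∧<⇒+≢+ : ∀ {i j k l} → i ≤ k → j < l → i + j ≢ k + l
≤∧<⇒+≢+ i≤k j<l eq = ℤ.<-irrefl eq (ℤ.+-mono-≤-< i≤k j<l)

+≡+∧≤⇒≥ : ∀ {i j k l} → i + j ≡ k + l → j ≤ l → k ≤ i
+≡+∧≤⇒≥ eq j≤l = ℤ.≮⇒≥ λ i<k → ℤ.<-irrefl eq (ℤ.+-mono-<-≤ i<k j≤l)

⊈⇒∃∉ : p ⊈ q → ∃ λ x → x ∈ p × x ∉ q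
⊈⇒∃∉ {p = p} {q} p⊈q with Fin.any? (λ x → (x ∈? p) ×-dec ¬? (x ∈? q))
... | yes witness = witness
... | no  none    = contradiction
  (λ {x} x∈p → decidable-stable (x ∈? q) λ x∉q → none (x , x∈p , x∉q)) p⊈q

x∈p∧x∉p-y⇒x≡y : x ∈ p → x ∉ p ─ ⁅ y ⁆ → x ≡ y
x∈p∧x∉p-y⇒x≡y {x = x} {y = y} x∈p x∉p-y =
  decidable-stable (x ≟ y) (x∉p-y ∘ x∈p∧x≢y⇒x∈p-y x∈p)

⊆∧∣∣≤⇒≡ : p ⊆ q → ∣ q ∣ ℕ.≤ ∣ p ∣ → q ≡ p
⊆∧∣∣≤⇒≡ {p = p} {q} p⊆q ∣q∣≤∣p∣ = ⊆-antisym q⊆p p⊆q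
  where
  q⊆p : q ⊆ p
  q⊆p {x} x∈q = decidable-stable (x ∈? p) λ x∉p →
    ℕ.<⇒≱ (p⊂q⇒∣p∣<∣q∣ (p⊆q , x , x∈q , x∉p)) ∣q∣≤∣p∣

∣p∪⁅x⁆∣≡1+∣p∣ : ∀ (p : Subset n) {x} → x ∉ p → ∣ p ∪ ⁅ x ⁆ ∣ ≡ suc ∣ p ∣
∣p∪⁅x⁆∣≡1+∣p∣ (inside  ∷ p) {zero}  x∉p = contradiction here x∉p
∣p∪⁅x⁆∣≡1+∣p∣ (outside ∷ p) {zero}  _   = cong (suc ∘ ∣_∣) (∪-identityʳ p)
∣p∪⁅x⁆∣≡1+∣p∣ (inside  ∷ p) {suc x} x∉p = cong suc (∣p∪⁅x⁆∣≡1+∣p∣ p (x∉p ∘ there))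
∣p∪⁅x⁆∣≡1+∣p∣ (outside ∷ p) {suc x} x∉p = ∣p∪⁅x⁆∣≡1+∣p∣ p (x∉p ∘ there)

1+∣p-x∣≡∣p∣ : ∀ (p : Subset n) {x} → x ∈ p → suc ∣ p ─ ⁅ x ⁆ ∣ ≡ ∣ p ∣
1+∣p-x∣≡∣p∣ (inside  ∷ p) {zero}  here        = cong (suc ∘ ∣_∣) (p─⊥≡p p)
1+∣p-x∣≡∣p∣ (inside  ∷ p) {suc x} (there x∈p) = cong suc (1+∣p-x∣≡∣p∣ p x∈p)
1+∣p-x∣≡∣p∣ (outside ∷ p) {suc x} (there x∈p) = 1+∣p-x∣≡∣p∣ p x∈p

∣p-x∪⁅y⁆∣≡∣p∣ : x ∈ p → y ∉ p → ∣ (p ─ ⁅ x ⁆) ∪ ⁅ y ⁆ ∣ ≡ ∣ p ∣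
∣p-x∪⁅y⁆∣≡∣p∣ {p = p} x∈p y∉p =
  trans (∣p∪⁅x⁆∣≡1+∣p∣ _ (y∉p ∘ p─q⊆p p _)) (1+∣p-x∣≡∣p∣ p x∈p)

subset : {P : Pred (Fin n) ℓ} → Decidable P → Subset n
subset P? = tabulate (does ∘ P?)

∈subset⁺ : {P : Pred (Fin n) ℓ} (P? : Decidable P) → P x → x ∈ subset P?
∈subset⁺ {x = x} P? Px = lookup⇒[]= x _ (trans (lookup∘tabulate _ x) (dec-true (P? x) Px))

∈subset⁻ : {P : Pred (Fin n) ℓ} (P? : Decidable P) → x ∈ subset P? → P x
∈subset⁻ {x = x} P? x∈ = decidable-stable (P? x) λ ¬Px → true≢false
  (trans (sym ([]=⇒lookup x∈)) (trans (lookup∘tabulate _ x) (dec-false (P? x) ¬Px)))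
  where
  true≢false : true ≢ false
  true≢false ()

allSubset? : {P : Pred (Subset n) ℓ} → Decidable P → Dec (∀ p → P p)
allSubset? P? with anySubset? (¬? ∘ P?)
... | yes (p , ¬Pp) = no λ ∀P → ¬Pp (∀P p)
... | no  ∄¬P       = yes λ p → decidable-stable (P? p) λ ¬Pp → ∄¬P (p , ¬Pp)

IsArgmax : Pred (Subset n) ℓ → (Subset n → ℤ) → Subset n → Set ℓ
IsArgmax P f p = P p × (∀ q → P q → f q ≤ f p)

argmax : {P : Pred (Subset n) ℓ} → Decidable P → (f : Subset n → ℤ) → ∃ P → ∃ (IsArgmax P f)
argmax {n = zero}  P? f ([] , P[]) = [] , P[] , λ { [] _ → ℤ.≤-refl }
argmax {n = suc n} P? f ∃P
  with anySubset? (P? ∘ (inside ∷_)) | anySubset? (P? ∘ (outside ∷_))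
... | yes ∃ᵢ | yes ∃ₒ
  with argmax (P? ∘ (inside ∷_)) (f ∘ (inside ∷_)) ∃ᵢ | argmax (P? ∘ (outside ∷_)) (f ∘ (outside ∷_)) ∃ₒ
...   | pᵢ , Ppᵢ , maxᵢ | pₒ , Ppₒ , maxₒ with ℤ.≤-total (f (inside ∷ pᵢ)) (f (outside ∷ pₒ))
...     | inj₁ fᵢ≤fₒ = outside ∷ pₒ , Ppₒ , λ
  { (inside ∷ q) Pq → ℤ.≤-trans (maxᵢ q Pq) fᵢ≤fₒ ; (outside ∷ q) Pq → maxₒ q Pq }
...     | inj₂ fₒ≤fᵢ = inside ∷ pᵢ , Ppᵢ , λ
  { (inside ∷ q) Pq → maxᵢ q Pq ; (outside ∷ q) Pq → ℤ.≤-trans (maxₒ q Pq) fₒ≤fᵢ }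
argmax P? f ∃P | yes ∃ᵢ | no ∄ₒ with argmax (P? ∘ (inside ∷_)) (f ∘ (inside ∷_)) ∃ᵢ
... | pᵢ , Ppᵢ , maxᵢ = inside ∷ pᵢ , Ppᵢ , λ
  { (inside ∷ q) Pq → maxᵢ q Pq ; (outside ∷ q) Pq → contradiction (q , Pq) ∄ₒ }
argmax P? f ∃P | no ∄ᵢ | yes ∃ₒ with argmax (P? ∘ (outside ∷_)) (f ∘ (outside ∷_)) ∃ₒ
... | pₒ , Ppₒ , maxₒ = outside ∷ pₒ , Ppₒ , λ
  { (inside ∷ q) Pq → contradiction (q , Pq) ∄ᵢ ; (outside ∷ q) Pq → maxₒ q Pq }
argmax P? f ((inside  ∷ p) , Pp) | no ∄ᵢ | no _ = contradiction (p , Pp) ∄ᵢ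
argmax P? f ((outside ∷ p) , Pp) | no _ | no ∄ₒ = contradiction (p , Pp) ∄ₒ

weight-∪⁅⁆ : ∀ (z : Fin n → ℤ) (p : Subset n) {x} → x ∉ p → weight z (p ∪ ⁅ x ⁆) ≡ weight z p + z x
weight-∪⁅⁆ z (inside  ∷ p) {zero}  x∉p = contradiction here x∉p
weight-∪⁅⁆ z (outside ∷ p) {zero}  _   =
  trans (cong (λ r → z zero + weight (z ∘ suc) r) (∪-identityʳ p)) (ℤ.+-comm (z zero) _)
weight-∪⁅⁆ z (inside  ∷ p) {suc x} x∉p =
  trans (cong (λ r → z zero + r) (weight-∪⁅⁆ (z ∘ suc) p (x∉p ∘ there))) (sym (ℤ.+-assoc (z zero) _ (z (suc x))))
weight-∪⁅⁆ z (outside ∷ p) {suc x} x∉p = weight-∪⁅⁆ (z ∘ suc) p (x∉p ∘ there)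

weight-─⁅⁆ : ∀ (z : Fin n → ℤ) (p : Subset n) {x} → x ∈ p → weight z (p ─ ⁅ x ⁆) + z x ≡ weight z p
weight-─⁅⁆ z (inside  ∷ p) {zero}  here        =
  trans (cong (λ r → weight (z ∘ suc) r + z zero) (p─⊥≡p p)) (ℤ.+-comm _ (z zero))
weight-─⁅⁆ z (inside  ∷ p) {suc x} (there x∈p) =
  trans (ℤ.+-assoc (z zero) _ (z (suc x))) (cong (λ r → z zero + r) (weight-─⁅⁆ (z ∘ suc) p x∈p))
weight-─⁅⁆ z (outside ∷ p) {suc x} (there x∈p) = weight-─⁅⁆ (z ∘ suc) p x∈p

weight-exchange : ∀ (z : Fin n → ℤ) → x ∈ p → y ∉ p →
                  weight z ((p ─ ⁅ x ⁆) ∪ ⁅ y ⁆) + z x ≡ weight z p + z y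
weight-exchange {x = x} {p = p} {y = y} z x∈p y∉p = begin
  weight z ((p ─ ⁅ x ⁆) ∪ ⁅ y ⁆) + z x  ≡⟨ cong (_+ z x) (weight-∪⁅⁆ z (p ─ ⁅ x ⁆) (y∉p ∘ p─q⊆p p _)) ⟩
  weight z (p ─ ⁅ x ⁆) + z y + z x      ≡⟨ xy∙z≈xz∙y (weight z (p ─ ⁅ x ⁆)) (z y) (z x) ⟩
  weight z (p ─ ⁅ x ⁆) + z x + z y      ≡⟨ cong (_+ z y) (weight-─⁅⁆ z p x∈p) ⟩
  weight z p + z y                  ∎
  where open ≡-Reasoning

-- Matroids

module _ (M : Matroid n) where

  private
    variable
      B B₀ X Y : Subset n

  indep⇒∣∣≤basis : Indep M X → IsBasis M B → ∣ X ∣ ℕ.≤ ∣ B ∣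
  indep⇒∣∣≤basis indX (indB , maxB) = ℕ.≮⇒≥ λ ∣B∣<∣X∣ →
    let e , _ , e∉B , indB∪e = exchange M indB indX ∣B∣<∣X∣
    in e∉B (subst (e ∈_) (maxB _ indB∪e (p⊆p∪q _)) (x∈p∪q⁺ (inj₂ (x∈⁅x⁆ e))))

  indep∧∣basis∣≤⇒basis : IsBasis M B → Indep M X → ∣ B ∣ ℕ.≤ ∣ X ∣ → IsBasis M X
  indep∧∣basis∣≤⇒basis basisB indX ∣B∣≤∣X∣ =
    indX , λ Y indY X⊆Y → ⊆∧∣∣≤⇒≡ X⊆Y (ℕ.≤-trans (indep⇒∣∣≤basis indY basisB) ∣B∣≤∣X∣)

  augment : Indep M X → Indep M Y → ∣ X ∣ ℕ.≤ ∣ Y ∣ →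
            ∃ λ Z → Indep M Z × X ⊆ Z × Z ⊆ X ∪ Y × ∣ Z ∣ ≡ ∣ Y ∣
  augment {X} {Y} indX indY ∣X∣≤∣Y∣ = go (∣ Y ∣ ℕ.∸ ∣ X ∣) indX (ℕ.m+[n∸m]≡n ∣X∣≤∣Y∣)
    where
    go : ∀ {X} k → Indep M X → ∣ X ∣ ℕ.+ k ≡ ∣ Y ∣ →
         ∃ λ Z → Indep M Z × X ⊆ Z × Z ⊆ X ∪ Y × ∣ Z ∣ ≡ ∣ Y ∣
    go {X} zero indX eq = X , indX , id , p⊆p∪q Y , trans (sym (ℕ.+-identityʳ _)) eq
    go {X} (suc k) indX eq
      with exchange M indX indY (subst (∣ X ∣ ℕ.<_) eq (ℕ.m<m+n ∣ X ∣ ℕ.z<s))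
    ... | e , e∈Y , e∉X , indX∪e
      with go k indX∪e (trans (cong (ℕ._+ k) (∣p∪⁅x⁆∣≡1+∣p∣ X e∉X)) (trans (sym (ℕ.+-suc _ k)) eq))
    ...   | Z , indZ , X∪e⊆Z , Z⊆X∪e∪Y , ∣Z∣≡∣Y∣ =
      Z , indZ , X∪e⊆Z ∘ p⊆p∪q _ , X∪e∪Y⊆X∪Y ∘ Z⊆X∪e∪Y , ∣Z∣≡∣Y∣
      where
      X∪e∪Y⊆X∪Y : (X ∪ ⁅ e ⁆) ∪ Y ⊆ X ∪ Y
      X∪e∪Y⊆X∪Y x∈ with x∈p∪q⁻ _ Y x∈
      ... | inj₂ x∈Y = q⊆p∪q X Y x∈Y
      ... | inj₁ x∈X∪e with x∈p∪q⁻ X _ x∈X∪e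
      ...   | inj₁ x∈X = p⊆p∪q Y x∈X
      ...   | inj₂ x∈e = subst (_∈ X ∪ Y) (sym (x∈⁅y⁆⇒x≡y e x∈e)) (q⊆p∪q X Y e∈Y)

  isBasis? : Decidable (IsBasis M)
  isBasis? B = indep? M B ×-dec allSubset? λ X → indep? M X →-dec (B ⊆? X →-dec ≡-dec _≟ᵇ_ X B)

  isMaxWeightBasis? : ∀ v → Decidable (IsMaxWeightBasis M v)
  isMaxWeightBasis? v B =
    isBasis? B ×-dec allSubset? λ B′ → isBasis? B′ →-dec (weight v B′ ℤ.≤? weight v B)

  maxWeightBasis : IsBasis M B → ∀ v → ∃ (IsMaxWeightBasis M v)
  maxWeightBasis basisB v = argmax isBasis? (weight v) (_ , basisB)

  module _ {u : Fin n → ℤ} {e : Fin n} (maxB₀ : IsMaxWeightBasis M u B₀) (e∉B₀ : e ∉ B₀) where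

    heavy? : Decidable λ s → s ∈ B₀ × u e ≤ u s
    heavy? s = (s ∈? B₀) ×-dec (u e ℤ.≤? u s)

    heavy : Subset n
    heavy = subset heavy?

    heavy⊆B₀ : heavy ⊆ B₀
    heavy⊆B₀ = proj₁ ∘ ∈subset⁻ heavy?

    indHeavy : Indep M heavy
    indHeavy = hereditary M heavy⊆B₀ (proj₁ (proj₁ maxB₀))

    light : ∀ {s} → s ∈ B₀ → s ∉ heavy → u s < u e
    light s∈B₀ s∉heavy = ℤ.≰⇒> λ e≤s → s∉heavy (∈subset⁺ heavy? (s∈B₀ , e≤s))

    -- Otherwise heavy ∪ ⁅ e ⁆ extends inside B₀ ∪ ⁅ e ⁆ to a basis B₀ − f + e with f light,
    -- which outweighs B₀.
    heavy∪⁅e⁆-dependent : ¬ Indep M (heavy ∪ ⁅ e ⁆)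
    heavy∪⁅e⁆-dependent indH∪e
      with augment indH∪e (proj₁ (proj₁ maxB₀)) (indep⇒∣∣≤basis indH∪e (proj₁ maxB₀))
    ... | Z , indZ , H∪e⊆Z , Z⊆H∪e∪B₀ , ∣Z∣≡∣B₀∣ = ≤∧<⇒+≢+ weightZ≤ (light f∈B₀ f∉H) exchanged
      where
      e∈Z : e ∈ Z
      e∈Z = H∪e⊆Z (q⊆p∪q heavy _ (x∈⁅x⁆ e))
      B₀⊈Z : B₀ ⊈ Z
      B₀⊈Z B₀⊆Z = e∉B₀ (subst (e ∈_) (⊆∧∣∣≤⇒≡ B₀⊆Z (ℕ.≤-reflexive ∣Z∣≡∣B₀∣)) e∈Z)
      f = proj₁ (⊈⇒∃∉ B₀⊈Z)
      f∈B₀ = proj₁ (proj₂ (⊈⇒∃∉ B₀⊈Z))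
      f∉Z = proj₂ (proj₂ (⊈⇒∃∉ B₀⊈Z))
      f∉H : f ∉ heavy
      f∉H = f∉Z ∘ H∪e⊆Z ∘ p⊆p∪q _
      keep : ∀ {x} → x ∈ Z → x ∈ B₀ → x ∈ (B₀ ─ ⁅ f ⁆) ∪ ⁅ e ⁆
      keep x∈Z x∈B₀ = p⊆p∪q _ (x∈p∧x≢y⇒x∈p-y x∈B₀ λ { refl → f∉Z x∈Z })
      Z⊆B₀-f∪e : Z ⊆ (B₀ ─ ⁅ f ⁆) ∪ ⁅ e ⁆
      Z⊆B₀-f∪e x∈Z with x∈p∪q⁻ _ B₀ (Z⊆H∪e∪B₀ x∈Z)
      ... | inj₂ x∈B₀ = keep x∈Z x∈B₀
      ... | inj₁ x∈H∪e with x∈p∪q⁻ heavy _ x∈H∪e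
      ...   | inj₁ x∈H = keep x∈Z (heavy⊆B₀ x∈H)
      ...   | inj₂ x∈e = q⊆p∪q _ _ x∈e
      Z≡B₀-f∪e : (B₀ ─ ⁅ f ⁆) ∪ ⁅ e ⁆ ≡ Z
      Z≡B₀-f∪e = ⊆∧∣∣≤⇒≡ Z⊆B₀-f∪e
        (ℕ.≤-reflexive (trans (∣p-x∪⁅y⁆∣≡∣p∣ f∈B₀ e∉B₀) (sym ∣Z∣≡∣B₀∣)))
      weightZ≤ : weight u Z ≤ weight u B₀
      weightZ≤ = proj₂ maxB₀ Z (indep∧∣basis∣≤⇒basis (proj₁ maxB₀) indZ (ℕ.≤-reflexive (sym ∣Z∣≡∣B₀∣)))
      exchanged : weight u Z + u f ≡ weight u B₀ + u e
      exchanged = subst (λ Z′ → weight u Z′ + u f ≡ weight u B₀ + u e) Z≡B₀-f∪e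
        (weight-exchange u f∈B₀ e∉B₀)

    -- The element a that the exchange axiom adds to B − e from an extension of heavy inside
    -- heavy ∪ B is heavy: it cannot be e, because heavy ∪ ⁅ e ⁆ is dependent.
    basis-exchange : IsBasis M B → e ∈ B →
                     ∃ λ a → a ∈ B₀ × a ∉ B × u e ≤ u a × IsBasis M ((B ─ ⁅ e ⁆) ∪ ⁅ a ⁆)
    basis-exchange {B} basisB e∈B
      with augment indHeavy (proj₁ basisB) (indep⇒∣∣≤basis indHeavy basisB)
    ... | Z , indZ , H⊆Z , Z⊆H∪B , ∣Z∣≡∣B∣
      with exchange M {B ─ ⁅ e ⁆} (hereditary M (p─q⊆p B _) (proj₁ basisB)) indZ
             (subst (∣ B ─ ⁅ e ⁆ ∣ ℕ.<_) (sym ∣Z∣≡∣B∣) (x∈p⇒∣p-x∣<∣p∣ e∈B))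
    ...   | a , a∈Z , a∉B-e , indB-e∪a = a , a∈B₀ , a∉B , e≤a ,
      indep∧∣basis∣≤⇒basis basisB indB-e∪a (ℕ.≤-reflexive (sym (∣p-x∪⁅y⁆∣≡∣p∣ e∈B a∉B)))
      where
      a∈H : a ∈ heavy
      a∈H with x∈p∪q⁻ heavy B (Z⊆H∪B a∈Z)
      ... | inj₁ a∈H = a∈H
      ... | inj₂ a∈B = contradiction (hereditary M H∪e⊆Z indZ) heavy∪⁅e⁆-dependent
        where
        H∪e⊆Z : heavy ∪ ⁅ e ⁆ ⊆ Z
        H∪e⊆Z x∈ with x∈p∪q⁻ heavy _ x∈
        ... | inj₁ x∈H = H⊆Z x∈H
        ... | inj₂ x∈e = subst (_∈ Z) (sym (x∈⁅y⁆⇒x≡y e x∈e))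
                           (subst (_∈ Z) (x∈p∧x∉p-y⇒x≡y a∈B a∉B-e) a∈Z)
      a∈B₀ = heavy⊆B₀ a∈H
      e≤a = proj₂ (∈subset⁻ heavy? a∈H)
      a∉B : a ∉ B
      a∉B a∈B = e∉B₀ (subst (_∈ B₀) (x∈p∧x∉p-y⇒x≡y a∈B a∉B-e) a∈B₀)

-- Shifted weights and ℓ∞ distance

χ-∈ : x ∈ p → χ p x ≡ + 1
χ-∈ x∈p rewrite []=⇒lookup x∈p = refl

χ-∉ : x ∉ p → χ p x ≡ + 0
χ-∉ {x = x} {p = p} x∉p with lookup p x in eq
... | inside  = contradiction (lookup⇒[]= x p eq) x∉p
... | outside = refl

module _ (w : Fin n → ℤ) {S : Subset n} (c : ℕ) where

  shift-∈ : x ∈ S → shift w S c x ≡ w x - + c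
  shift-∈ {x} x∈S =
    trans (cong₂ (λ i j → w x + + c ℤ.* (i - j)) (χ-∉ (x∈p⇒x∉∁p x∈S)) (χ-∈ x∈S)) (lower (w x) (+ c))
    where
    lower : ∀ i k → i + k ℤ.* (+ 0 - + 1) ≡ i - k
    lower = solve-∀

  shift-∉ : x ∉ S → shift w S c x ≡ w x + + c
  shift-∉ {x} x∉S =
    trans (cong₂ (λ i j → w x + + c ℤ.* (i - j)) (χ-∈ (x∉p⇒x∈∁p x∉S)) (χ-∉ x∉S)) (raise (w x) (+ c))
    where
    raise : ∀ i k → i + k ℤ.* (+ 1 - + 0) ≡ i + k
    raise = solve-∀

  ∣w-shift∣≡c : ∀ x → ℤ.∣ w x - shift w S c x ∣ ≡ c
  ∣w-shift∣≡c x with x ∈? S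
  ... | yes x∈S = cong ℤ.∣_∣ (trans (cong (λ i → w x - i) (shift-∈ x∈S)) (cancel (w x) (+ c)))
    where
    cancel : ∀ i k → i - (i - k) ≡ k
    cancel = solve-∀
  ... | no  x∉S = trans (cong ℤ.∣_∣ (trans (cong (λ i → w x - i) (shift-∉ x∉S)) (cancel (w x) (+ c))))
                        (ℤ.∣-i∣≡∣i∣ (+ c))
    where
    cancel : ∀ i k → i - (i + k) ≡ - k
    cancel = solve-∀

  module _ {w′ : Fin n → ℤ} {x : Fin n} (close : ℤ.∣ w x - w′ x ∣ ℕ.≤ c) where

    ∉⇒≤shift : x ∉ S → w′ x ≤ shift w S c x
    ∉⇒≤shift x∉S = subst (w′ x ≤_) (sym (shift-∉ x∉S)) (∣i-j∣≤k⇒j≤i+k (w x) (w′ x) close)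

    ∈⇒shift≤ : x ∈ S → shift w S c x ≤ w′ x
    ∈⇒shift≤ x∈S = subst (_≤ w′ x) (sym (shift-∈ x∈S)) (∣i-j∣≤k⇒i-k≤j (w x) (w′ x) close)

shift-∉-< : ∀ (w : Fin n → ℤ) {S} c → x ∉ S → shift w S c x < shift w S (suc c) x
shift-∉-< w c x∉S rewrite shift-∉ w c x∉S | shift-∉ w (suc c) x∉S =
  ℤ.+-monoʳ-< (w _) (+<+ (ℕ.n<1+n c))

shift-∈-< : ∀ (w : Fin n → ℤ) {S} c → x ∈ S → shift w S (suc c) x < shift w S c x
shift-∈-< w c x∈S rewrite shift-∈ w c x∈S | shift-∈ w (suc c) x∈S =
  ℤ.+-monoʳ-< (w _) (ℤ.neg-mono-< (+<+ (ℕ.n<1+n c)))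

χ-∉<χ-∈ : x ∉ p → y ∈ p → χ p x < χ p y
χ-∉<χ-∈ x∉p y∈p rewrite χ-∉ x∉p | χ-∈ y∈p = +<+ ℕ.z<s

distInf≤⇒∣-∣≤ : ∀ {w w′ : Fin n → ℤ} {c} → distInf w w′ ℕ.≤ c → ∀ x → ℤ.∣ w x - w′ x ∣ ℕ.≤ c
distInf≤⇒∣-∣≤ d≤c zero    = ℕ.m⊔n≤o⇒m≤o _ _ d≤c
distInf≤⇒∣-∣≤ {w = w} {w′} d≤c (suc x) =
  distInf≤⇒∣-∣≤ {w = w ∘ suc} {w′ ∘ suc} (ℕ.m⊔n≤o⇒n≤o _ _ d≤c) x

-- On an empty ground set distInf is 0 whatever c is, hence the point of Fin n.
distInf-const : ∀ {w w′ : Fin n → ℤ} {c} → Fin n → (∀ x → ℤ.∣ w x - w′ x ∣ ≡ c) → distInf w w′ ≡ c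
distInf-const {n = suc zero}    _ ∣-∣≡c = trans (ℕ.⊔-identityʳ _) (∣-∣≡c zero)
distInf-const {n = suc (suc n)} {w} {w′} {c} _ ∣-∣≡c =
  trans (cong₂ ℕ._⊔_ (∣-∣≡c zero) (distInf-const {w = w ∘ suc} {w′ ∘ suc} zero (∣-∣≡c ∘ suc)))
        (ℕ.⊔-idem c)

distInf-shift : ∀ (w : Fin n → ℤ) S c → Fin n → distInf w (shift w S c) ≡ c
distInf-shift w S c x = distInf-const x (∣w-shift∣≡c w {S} c)

-- IM-Not-Exists and its relaxation

module _ (M : Matroid n) (S₀ : Subset n) where

  notExistsFeasible? : ∀ v → Dec (NotExistsFeasible M S₀ v)
  notExistsFeasible? v = allSubset? λ B → B ⊆? S₀ →-dec ¬? (isMaxWeightBasis? M v B)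

  notExists⇒relaxed : ∀ {B v} → IsBasis M B → NotExistsFeasible M S₀ v → RelaxedFeasible M S₀ v
  notExists⇒relaxed basisB feasible =
    let B′ , maxB′ = maxWeightBasis M basisB _ in B′ , maxB′ , λ B′⊆S₀ → feasible B′ B′⊆S₀ maxB′

  module _ (w : Fin n → ℤ) where

    shift-order-transfer : ∀ {w′ c x y} → distInf w w′ ℕ.≤ c → x ∉ S₀ → y ∈ S₀ →
                           shift w S₀ c x ≤ shift w S₀ c y → w′ x ≤ w′ y
    shift-order-transfer {w′} {c} {x} {y} d≤c x∉S₀ y∈S₀ x≤y = begin
      w′ x            ≤⟨ ∉⇒≤shift w c {w′} (distInf≤⇒∣-∣≤ d≤c x) x∉S₀ ⟩
      shift w S₀ c x  ≤⟨ x≤y ⟩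
      shift w S₀ c y  ≤⟨ ∈⇒shift≤ w c {w′} (distInf≤⇒∣-∣≤ d≤c y) y∈S₀ ⟩
      w′ y            ∎
      where open ℤ.≤-Reasoning

    shift-suc-order-transfer : ∀ {ŵ δ x y} → distInf w ŵ ℕ.≤ δ → x ∉ S₀ → y ∈ S₀ →
                               shift w S₀ (suc δ) x ≤ shift w S₀ (suc δ) y → ŵ x < ŵ y
    shift-suc-order-transfer {ŵ} {δ} {x} {y} d≤δ x∉S₀ y∈S₀ x≤y = begin-strict
      ŵ x                   ≤⟨ ∉⇒≤shift w δ {ŵ} (distInf≤⇒∣-∣≤ d≤δ x) x∉S₀ ⟩
      shift w S₀ δ x        <⟨ shift-∉-< w δ x∉S₀ ⟩
      shift w S₀ (suc δ) x  ≤⟨ x≤y ⟩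
      shift w S₀ (suc δ) y  <⟨ shift-∈-< w δ y∈S₀ ⟩
      shift w S₀ δ y        ≤⟨ ∈⇒shift≤ w δ {ŵ} (distInf≤⇒∣-∣≤ d≤δ y) y∈S₀ ⟩
      ŵ y                   ∎
      where open ℤ.≤-Reasoning

    shift-dominates : ∀ {B w′ c} → IsBasis M B → distInf w w′ ℕ.≤ c →
                      NotExistsFeasible M S₀ w′ → NotExistsFeasible M S₀ (shift w S₀ c)
    shift-dominates {w′ = w′} basis d≤c feasible′ B₀ B₀⊆S₀ maxB₀ =
      let B , maxB , mostInS₀ = argmax (isMaxWeightBasis? M w′) (weight (χ S₀)) (maxWeightBasis M basis w′)
          e , e∈B , e∉S₀ = ⊈⇒∃∉ λ B⊆S₀ → feasible′ B B⊆S₀ maxB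
          a , a∈B₀ , a∉B , e≤a , basisZ = basis-exchange M maxB₀ (e∉S₀ ∘ B₀⊆S₀) (proj₁ maxB) e∈B
          maxZ = basisZ , λ B′ basisB′ → ℤ.≤-trans (proj₂ maxB B′ basisB′)
                   (+≡+∧≤⇒≥ (weight-exchange w′ e∈B a∉B) (shift-order-transfer d≤c e∉S₀ (B₀⊆S₀ a∈B₀) e≤a))
      in ≤∧<⇒+≢+ (mostInS₀ _ maxZ) (χ-∉<χ-∈ e∉S₀ (B₀⊆S₀ a∈B₀)) (weight-exchange (χ S₀) e∈B a∉B)

    relaxed⇒shift-suc-feasible : ∀ {ŵ δ} → RelaxedFeasible M S₀ ŵ → distInf w ŵ ℕ.≤ δ →
                                 NotExistsFeasible M S₀ (shift w S₀ (suc δ))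
    relaxed⇒shift-suc-feasible {ŵ} (B* , (basisB* , maxB*) , B*⊈S₀) d≤δ B₀ B₀⊆S₀ maxB₀ =
      let e , e∈B* , e∉S₀ = ⊈⇒∃∉ B*⊈S₀
          a , a∈B₀ , a∉B* , e≤a , basisZ = basis-exchange M maxB₀ (e∉S₀ ∘ B₀⊆S₀) basisB* e∈B*
      in ≤∧<⇒+≢+ (maxB* _ basisZ) (shift-suc-order-transfer d≤δ e∉S₀ (B₀⊆S₀ a∈B₀) e≤a)
                 (weight-exchange ŵ e∈B* a∉B*)

lemma6p5 : ∀ {n} (M : Matroid n) (S₀ : Subset n) (w : Fin n → ℤ) →
    (∃ λ B → IsBasis M B × ¬ (B ⊆ S₀)) →
    (δ̂ : ℕ) → IsRelaxedOptValue M S₀ w δ̂ →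
    IsNotExistsOptimal M S₀ w (shift w S₀ δ̂) ⊎ IsNotExistsOptimal M S₀ w (shift w S₀ (suc δ̂))
lemma6p5 M S₀ w (B , basisB , B⊈S₀) δ̂ ((_ , relaxed , d≡δ̂) , δ̂-least) =
  case notExistsFeasible? M S₀ (shift w S₀ δ̂) of λ
    { (yes feasible)  → inj₁ (feasible , λ w′ → distInf-shift-≤ δ̂ ∘ δ̂≤ w′)
    ; (no infeasible) → inj₂ (relaxed⇒shift-suc-feasible M S₀ w relaxed (ℕ.≤-reflexive d≡δ̂) ,
        λ w′ feasible′ → distInf-shift-≤ (suc δ̂) (ℕ.≤∧≢⇒< (δ̂≤ w′ feasible′) λ δ̂≡d →
          infeasible (shift-dominates M S₀ w basisB (ℕ.≤-reflexive (sym δ̂≡d)) feasible′)))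
    }
  where
  δ̂≤ : ∀ w′ → NotExistsFeasible M S₀ w′ → δ̂ ℕ.≤ distInf w w′
  δ̂≤ w′ = δ̂-least w′ ∘ notExists⇒relaxed M S₀ basisB
  distInf-shift-≤ : ∀ {d} c → c ℕ.≤ d → distInf w (shift w S₀ c) ℕ.≤ d
  distInf-shift-≤ c = subst (ℕ._≤ _) (sym (distInf-shift w S₀ c (proj₁ (⊈⇒∃∉ B⊈S₀))))
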